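{- The relation $\equiv$ on hypergraphs is an equivalence relation.
   Context: A hypergraph $G=(V,X)$ consists of a finite vertex set $V$ and a family $X$ of subsets of $V$ (hyperedges). If $G$ has $n$ vertices and $m\ge1$ hyperedges, its vertex-hyperedge incidence matrix $M_G\in\{0,1\}^{n\times m}$ has $(i,j)$ entry $1$ iff vertex $i$ belongs to hyperedge $j$. A doubly stochastic matrix is a square nonnegative matrix whose rows and columns each sum to $1$. For hypergraphs $G,H$, write $G\equiv H$ if either $G$ and $H$ have the same number of vertices and no hyperedges, or there exist doubly stochastic matrices $S_1,S_2$ with $S_1M_G=M_HS_2^t$ and $M_GS_2=S_1^tM_H$.
   Formalization: The entries of the doubly stochastic matrices $S_1,S_2$ in the relation ≡ are taken in ℚ. -}

module Defs where

open import Data.Nat using (ℕ; zero; suc)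
open import Data.Fin using (Fin; zero; suc)
open import Data.Bool using (Bool; true; false)
open import Data.Vec using (Vec; lookup)
open import Data.Fin.Subset using (Subset; _∈_)
open import Data.Fin.Subset.Properties using (_∈?_)
open import Data.Rational using (ℚ; 0ℚ; 1ℚ; _+_; _*_; _≤_)
open import Data.Product using (Σ; _×_; ∃₂)
open import Data.Sum using (_⊎_)
open import Relation.Nullary using (yes; no)
open import Relation.Binary.PropositionalEquality using (_≡_)

Matrix : ℕ → ℕ → Set
Matrix a b = Fin a → Fin b → ℚ

∑ : ∀ {k} → (Fin k → ℚ) → ℚ
∑ {zero}  f = 0ℚ
∑ {suc k} f = f zero + ∑ (λ i → f (suc i))

_⊗_ : ∀ {a b c} → Matrix a b → Matrix b c → Matrix a c
(A ⊗ B) i k = ∑ (λ j → A i j * B j k)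

_ᵗ : ∀ {a b} → Matrix a b → Matrix b a
(A ᵗ) j i = A i j

DoublyStochastic : ∀ {a b} → Matrix a b → Set
DoublyStochastic {a} {b} S =
  (a ≡ b) ×
  ((∀ i j → 0ℚ ≤ S i j) ×
  ((∀ i → ∑ (λ j → S i j) ≡ 1ℚ) ×
   (∀ j → ∑ (λ i → S i j) ≡ 1ℚ)))

record Hypergraph : Set where
  constructor hypergraph
  field
    nV    : ℕ
    nE    : ℕ
    edges : Vec (Subset nV) nE
open Hypergraph public

incidence : (G : Hypergraph) → Matrix (nV G) (nE G)
incidence G i j with i ∈? lookup (edges G) j
... | yes _ = 1ℚ
... | no  _ = 0ℚ

_≡ₕ_ : Hypergraph → Hypergraph → Set
G ≡ₕ H =
  ((nV G ≡ nV H) × ((nE G ≡ 0) × (nE H ≡ 0)))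
  ⊎ Σ (Matrix (nV H) (nV G)) λ S₁ → Σ (Matrix (nE G) (nE H)) λ S₂ →
      DoublyStochastic S₁ × (DoublyStochastic S₂ ×
      ((∀ i j → (S₁ ⊗ MG) i j ≡ (MH ⊗ (S₂ ᵗ)) i j) ×
       (∀ i j → (MG ⊗ S₂) i j ≡ ((S₁ ᵗ) ⊗ MH) i j)))
  where
    MG = incidence G
    MH = incidence H

{-# OPTIONS --safe #-}
-- Identity matrices witness reflexivity. Transposing both witnesses swaps the
-- two defining equations, which gives symmetry. For transitivity the witnesses
-- are multiplied: doubly stochastic matrices are closed under products, and by
-- associativity S A = B R and T B = C Q give (T S) A = C (Q R). When one step
-- involves hypergraphs without hyperedges, squareness of the doubly stochastic
-- witnesses of the other step transfers the vertex and edge counts.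
module Submission where

open import Defs
open import Relation.Binary.Structures using (IsEquivalence)
open import Algebra.Bundles using (CommutativeRing)
open import Data.Nat using (zero; suc)
open import Data.Fin using (Fin; zero; suc)
open import Data.Rational using (ℚ; 0ℚ; 1ℚ; _+_; _*_; _≤_; nonNegative)
open import Data.Rational.Properties
  using (+-*-commutativeRing; +-mono-≤; +-identityˡ; +-identityʳ; *-comm; *-assoc;
         *-identityˡ; *-identityʳ; *-zeroˡ; ≤-refl; nonNegative⁻¹; nonNeg*nonNeg⇒nonNeg)
open import Data.Product using (_,_; proj₁)
open import Data.Sum using (inj₁; inj₂)
open import Function using (flip)
open import Relation.Binary.PropositionalEquality
  using (_≡_; _≗_; refl; sym; trans; cong; cong₂; subst; module ≡-Reasoning)
import Algebra.Properties.Semiring.Sum (CommutativeRing.semiring +-*-commutativeRing) as Sum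

open ≡-Reasoning

∑≡sum : ∀ {k} (f : Fin k → ℚ) → ∑ f ≡ Sum.sum f
∑≡sum {zero}  f = refl
∑≡sum {suc k} f = cong (f zero +_) (∑≡sum (λ i → f (suc i)))

∑-cong : ∀ {k} {f g : Fin k → ℚ} → f ≗ g → ∑ f ≡ ∑ g
∑-cong {f = f} {g} f≗g = trans (∑≡sum f) (trans (Sum.sum-cong-≗ f≗g) (sym (∑≡sum g)))

∑-zero : ∀ k → ∑ {k} (λ _ → 0ℚ) ≡ 0ℚ
∑-zero k = trans (∑≡sum {k} (λ _ → 0ℚ)) (Sum.sum-replicate-zero k)

*-distribˡ-∑ : ∀ {k} (c : ℚ) (f : Fin k → ℚ) → c * ∑ f ≡ ∑ (λ i → c * f i)
*-distribˡ-∑ c f = begin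
  c * ∑ f                  ≡⟨ cong (c *_) (∑≡sum f) ⟩
  c * Sum.sum f            ≡⟨ Sum.*-distribˡ-sum c f ⟩
  Sum.sum (λ i → c * f i)  ≡⟨ ∑≡sum (λ i → c * f i) ⟨
  ∑ (λ i → c * f i)        ∎

*-distribʳ-∑ : ∀ {k} (c : ℚ) (f : Fin k → ℚ) → ∑ f * c ≡ ∑ (λ i → f i * c)
*-distribʳ-∑ c f = begin
  ∑ f * c                  ≡⟨ cong (_* c) (∑≡sum f) ⟩
  Sum.sum f * c            ≡⟨ Sum.*-distribʳ-sum c f ⟩
  Sum.sum (λ i → f i * c)  ≡⟨ ∑≡sum (λ i → f i * c) ⟨
  ∑ (λ i → f i * c)        ∎

∑-comm : ∀ {a b} (f : Fin a → Fin b → ℚ) →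
         ∑ (λ i → ∑ (λ j → f i j)) ≡ ∑ (λ j → ∑ (λ i → f i j))
∑-comm f = begin
  ∑ (λ i → ∑ (f i))                    ≡⟨ ∑∑≡sum-sum f ⟩
  Sum.sum (λ i → Sum.sum (f i))        ≡⟨ Sum.∑-comm f ⟩
  Sum.sum (λ j → Sum.sum (flip f j))   ≡⟨ ∑∑≡sum-sum (flip f) ⟨
  ∑ (λ j → ∑ (flip f j))               ∎
  where
  ∑∑≡sum-sum : ∀ {a b} (g : Fin a → Fin b → ℚ) →
               ∑ (λ i → ∑ (g i)) ≡ Sum.sum (λ i → Sum.sum (g i))
  ∑∑≡sum-sum {a} g = trans (∑≡sum {a} (λ i → ∑ (g i))) (Sum.sum-cong-≗ (λ i → ∑≡sum (g i)))

∑-nonNegative : ∀ {k} (f : Fin k → ℚ) → (∀ i → 0ℚ ≤ f i) → 0ℚ ≤ ∑ f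
∑-nonNegative {zero}  f f≥0 = ≤-refl
∑-nonNegative {suc k} f f≥0 =
  subst (_≤ ∑ f) (+-identityˡ 0ℚ)
        (+-mono-≤ (f≥0 zero) (∑-nonNegative (λ i → f (suc i)) (λ i → f≥0 (suc i))))

*-nonNegative : ∀ {p q} → 0ℚ ≤ p → 0ℚ ≤ q → 0ℚ ≤ p * q
*-nonNegative {p} {q} p≥0 q≥0 =
  nonNegative⁻¹ (p * q) {{nonNeg*nonNeg⇒nonNeg p {{nonNegative p≥0}} q {{nonNegative q≥0}}}}

infix 4 _≐_

_≐_ : ∀ {a b} → Matrix a b → Matrix a b → Set
A ≐ B = ∀ i j → A i j ≡ B i j

≐-sym : ∀ {a b} {A B : Matrix a b} → A ≐ B → B ≐ A
≐-sym A≐B i j = sym (A≐B i j)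

≐-trans : ∀ {a b} {A B C : Matrix a b} → A ≐ B → B ≐ C → A ≐ C
≐-trans A≐B B≐C i j = trans (A≐B i j) (B≐C i j)

⊗-congˡ : ∀ {a b c} (A : Matrix a b) {B B′ : Matrix b c} → B ≐ B′ → A ⊗ B ≐ A ⊗ B′
⊗-congˡ A B≐B′ i k = ∑-cong (λ j → cong (A i j *_) (B≐B′ j k))

⊗-congʳ : ∀ {a b c} {A A′ : Matrix a b} (B : Matrix b c) → A ≐ A′ → A ⊗ B ≐ A′ ⊗ B
⊗-congʳ B A≐A′ i k = ∑-cong (λ j → cong (_* B j k) (A≐A′ i j))

⊗-assoc : ∀ {a b c d} (A : Matrix a b) (B : Matrix b c) (C : Matrix c d) →
          (A ⊗ B) ⊗ C ≐ A ⊗ (B ⊗ C)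
⊗-assoc A B C i l = begin
  ∑ (λ k → ∑ (λ j → A i j * B j k) * C k l)
    ≡⟨ ∑-cong (λ k → trans (*-distribʳ-∑ (C k l) (λ j → A i j * B j k))
                           (∑-cong (λ j → *-assoc (A i j) (B j k) (C k l)))) ⟩
  ∑ (λ k → ∑ (λ j → A i j * (B j k * C k l)))
    ≡⟨ ∑-comm (λ k j → A i j * (B j k * C k l)) ⟩
  ∑ (λ j → ∑ (λ k → A i j * (B j k * C k l)))
    ≡⟨ ∑-cong (λ j → *-distribˡ-∑ (A i j) (λ k → B j k * C k l)) ⟨
  ∑ (λ j → A i j * ∑ (λ k → B j k * C k l)) ∎

⊗-transpose : ∀ {a b c} (A : Matrix a b) (B : Matrix b c) → (A ⊗ B) ᵗ ≐ (B ᵗ) ⊗ (A ᵗ)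
⊗-transpose A B i k = ∑-cong (λ j → *-comm (A k j) (B j i))

-- The matrices are explicit since unfolding ⊗ to ∑ hides their dimensions from unification.
⊗-intertwine : ∀ {a b c d e f} (T : Matrix c b) (S : Matrix b a) (A : Matrix a d)
                 (B : Matrix b e) (C : Matrix c f) {R : Matrix e d} {Q : Matrix f e} →
               S ⊗ A ≐ B ⊗ R → T ⊗ B ≐ C ⊗ Q → (T ⊗ S) ⊗ A ≐ C ⊗ (Q ⊗ R)
⊗-intertwine T S A B C {R} {Q} SA≐BR TB≐CQ i j = begin
  ((T ⊗ S) ⊗ A) i j  ≡⟨ ⊗-assoc T S A i j ⟩
  (T ⊗ (S ⊗ A)) i j  ≡⟨ ⊗-congˡ T SA≐BR i j ⟩
  (T ⊗ (B ⊗ R)) i j  ≡⟨ ⊗-assoc T B R i j ⟨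
  ((T ⊗ B) ⊗ R) i j  ≡⟨ ⊗-congʳ R TB≐CQ i j ⟩
  ((C ⊗ Q) ⊗ R) i j  ≡⟨ ⊗-assoc C Q R i j ⟩
  (C ⊗ (Q ⊗ R)) i j  ∎

I : ∀ {n} → Matrix n n
I zero    zero    = 1ℚ
I zero    (suc j) = 0ℚ
I (suc i) zero    = 0ℚ
I (suc i) (suc j) = I i j

I-symmetric : ∀ {n} → I {n} ᵗ ≐ I
I-symmetric zero    zero    = refl
I-symmetric zero    (suc j) = refl
I-symmetric (suc i) zero    = refl
I-symmetric (suc i) (suc j) = I-symmetric i j

I-nonNegative : ∀ {n} (i j : Fin n) → 0ℚ ≤ I i j
I-nonNegative zero    zero    = nonNegative⁻¹ 1ℚ
I-nonNegative zero    (suc j) = ≤-refl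
I-nonNegative (suc i) zero    = ≤-refl
I-nonNegative (suc i) (suc j) = I-nonNegative i j

∑-I-select : ∀ {n} (i : Fin n) (f : Fin n → ℚ) → ∑ (λ j → I i j * f j) ≡ f i
∑-I-select {suc n} zero f = begin
  1ℚ * f zero + ∑ (λ j → 0ℚ * f (suc j))
    ≡⟨ cong₂ _+_ (*-identityˡ (f zero)) (∑-cong (λ j → *-zeroˡ (f (suc j)))) ⟩
  f zero + ∑ {n} (λ _ → 0ℚ)
    ≡⟨ cong (f zero +_) (∑-zero n) ⟩
  f zero + 0ℚ
    ≡⟨ +-identityʳ (f zero) ⟩
  f zero ∎
∑-I-select {suc n} (suc i) f =
  trans (cong₂ _+_ (*-zeroˡ (f zero)) (∑-I-select i (λ j → f (suc j)))) (+-identityˡ (f (suc i)))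

⊗-identityˡ : ∀ {a b} (A : Matrix a b) → I ⊗ A ≐ A
⊗-identityˡ A i k = ∑-I-select i (λ j → A j k)

⊗-identityʳ : ∀ {a b} (A : Matrix a b) → A ⊗ I ≐ A
⊗-identityʳ A i k =
  trans (∑-cong (λ j → trans (*-comm (A i j) (I j k)) (cong (_* A i j) (I-symmetric k j))))
        (∑-I-select k (A i))

I-rowSum : ∀ {n} (i : Fin n) → ∑ (λ j → I i j) ≡ 1ℚ
I-rowSum i = trans (∑-cong (λ j → sym (*-identityʳ (I i j)))) (∑-I-select i (λ _ → 1ℚ))

I-doublyStochastic : ∀ {n} → DoublyStochastic (I {n})
I-doublyStochastic =
  refl , I-nonNegative , I-rowSum ,
  (λ j → trans (∑-cong (λ i → I-symmetric j i)) (I-rowSum j))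

ᵗ-doublyStochastic : ∀ {a b} {S : Matrix a b} → DoublyStochastic S → DoublyStochastic (S ᵗ)
ᵗ-doublyStochastic (a≡b , S≥0 , rows , cols) = sym a≡b , (λ i j → S≥0 j i) , cols , rows

⊗-doublyStochastic : ∀ {a b c} {A : Matrix a b} {B : Matrix b c} →
                     DoublyStochastic A → DoublyStochastic B → DoublyStochastic (A ⊗ B)
⊗-doublyStochastic {A = A} {B} (a≡b , A≥0 , rowsA , colsA) (b≡c , B≥0 , rowsB , colsB) =
  trans a≡b b≡c ,
  (λ i k → ∑-nonNegative _ (λ j → *-nonNegative (A≥0 i j) (B≥0 j k))) ,
  rows ,
  cols
  where
  rows : ∀ i → ∑ (λ k → (A ⊗ B) i k) ≡ 1ℚ
  rows i = begin
    ∑ (λ k → ∑ (λ j → A i j * B j k))  ≡⟨ ∑-comm (λ j k → A i j * B j k) ⟨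
    ∑ (λ j → ∑ (λ k → A i j * B j k))  ≡⟨ ∑-cong (λ j → *-distribˡ-∑ (A i j) (B j)) ⟨
    ∑ (λ j → A i j * ∑ (B j))          ≡⟨ ∑-cong (λ j → trans (cong (A i j *_) (rowsB j)) (*-identityʳ (A i j))) ⟩
    ∑ (A i)                            ≡⟨ rowsA i ⟩
    1ℚ                                 ∎
  cols : ∀ k → ∑ (λ i → (A ⊗ B) i k) ≡ 1ℚ
  cols k = begin
    ∑ (λ i → ∑ (λ j → A i j * B j k))      ≡⟨ ∑-comm (λ i j → A i j * B j k) ⟩
    ∑ (λ j → ∑ (λ i → A i j * B j k))      ≡⟨ ∑-cong (λ j → *-distribʳ-∑ (B j k) (λ i → A i j)) ⟨
    ∑ (λ j → ∑ (λ i → A i j) * B j k)      ≡⟨ ∑-cong (λ j → trans (cong (_* B j k) (colsA j)) (*-identityˡ (B j k))) ⟩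
    ∑ (λ j → B j k)                        ≡⟨ colsB k ⟩
    1ℚ                                     ∎

≡ₕ-refl : ∀ {G} → G ≡ₕ G
≡ₕ-refl {G} = inj₂ (I , I , I-doublyStochastic , I-doublyStochastic ,
  ≐-trans (⊗-identityˡ M) (≐-sym (≐-trans (⊗-congˡ M I-symmetric) (⊗-identityʳ M))) ,
  ≐-trans (⊗-identityʳ M) (≐-sym (≐-trans (⊗-congʳ M I-symmetric) (⊗-identityˡ M))))
  where M = incidence G

≡ₕ-sym : ∀ {G H} → G ≡ₕ H → H ≡ₕ G
≡ₕ-sym (inj₁ (nV≡ , nE₁≡0 , nE₂≡0)) = inj₁ (sym nV≡ , nE₂≡0 , nE₁≡0)
≡ₕ-sym (inj₂ (S₁ , S₂ , S₁-ds , S₂-ds , eq₁ , eq₂)) =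
  inj₂ (S₁ ᵗ , S₂ ᵗ , ᵗ-doublyStochastic S₁-ds , ᵗ-doublyStochastic S₂-ds ,
        ≐-sym eq₂ , ≐-sym eq₁)

≡ₕ-trans : ∀ {G H K} → G ≡ₕ H → H ≡ₕ K → G ≡ₕ K
≡ₕ-trans (inj₁ (nV≡ , nE₁≡0 , _)) (inj₁ (nV≡′ , _ , nE₃≡0)) = inj₁ (trans nV≡ nV≡′ , nE₁≡0 , nE₃≡0)
≡ₕ-trans (inj₁ (nV≡ , nE₁≡0 , nE₂≡0)) (inj₂ (T₁ , T₂ , T₁-ds , T₂-ds , _)) =
  inj₁ (trans nV≡ (sym (proj₁ T₁-ds)) , nE₁≡0 , trans (sym (proj₁ T₂-ds)) nE₂≡0)
≡ₕ-trans (inj₂ (S₁ , S₂ , S₁-ds , S₂-ds , _)) (inj₁ (nV≡ , nE₂≡0 , nE₃≡0)) =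
  inj₁ (trans (sym (proj₁ S₁-ds)) nV≡ , trans (proj₁ S₂-ds) nE₂≡0 , nE₃≡0)
≡ₕ-trans {G} {H} {K} (inj₂ (S₁ , S₂ , S₁-ds , S₂-ds , e₁ , e₂)) (inj₂ (T₁ , T₂ , T₁-ds , T₂-ds , f₁ , f₂)) =
  inj₂ (T₁ ⊗ S₁ , S₂ ⊗ T₂ , ⊗-doublyStochastic T₁-ds S₁-ds , ⊗-doublyStochastic S₂-ds T₂-ds ,
        ≐-trans forward (⊗-congˡ MK (≐-sym (⊗-transpose S₂ T₂))) ,
        ≐-sym (≐-trans (⊗-congʳ MK (⊗-transpose T₁ S₁)) backward))
  where
  MG = incidence G
  MH = incidence H
  MK = incidence K
  forward : (T₁ ⊗ S₁) ⊗ MG ≐ MK ⊗ ((T₂ ᵗ) ⊗ (S₂ ᵗ))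
  forward = ⊗-intertwine T₁ S₁ MG MH MK e₁ f₁
  -- the first equation for the reversed chain K ≡ₕ H ≡ₕ G
  backward : ((S₁ ᵗ) ⊗ (T₁ ᵗ)) ⊗ MK ≐ MG ⊗ (S₂ ⊗ T₂)
  backward = ⊗-intertwine (S₁ ᵗ) (T₁ ᵗ) MK MH MG (≐-sym f₂) (≐-sym e₂)

mainTheorem3 : IsEquivalence _≡ₕ_
mainTheorem3 = record { refl = ≡ₕ-refl ; sym = ≡ₕ-sym ; trans = ≡ₕ-trans }
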